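{- Let $X$ be a finite nonempty set, let $Q$ be a quintet system in $X$ which is thin, transitive and saturated, and let $S$ be the quartet system associated to $Q$. Then $S$ is saturated: for all pairwise distinct $a_1,a_2,b_1,b_2,x\in X$, if $(a_1,a_2|b_1,b_2)\in S$ then $(a_1,x|b_1,b_2)\in S$ or $(a_1,a_2|b_1,x)\in S$.
   Context: A quintet in $X$ is a partition of a $5$-element subset of $X$ whose block sizes are $(2,2,1)$, $(3,2)$ or $(5)$; for pairwise distinct $a,b,c,d,e\in X$ write $(a,b|c,d|e)$ for $\{\{a,b\},\{c,d\},\{e\}\}$, $(a,b|c,d,e)$ for $\{\{a,b\},\{c,d,e\}\}$, $(a,b,c,d,e)$ for $\{\{a,b,c,d,e\}\}$ (order inside blocks and order of blocks of equal size irrelevant). A quintet system is a set $Q$ of quintets. A quartet in $X$ is a partition of a $4$-subset of $X$ of kind $(2,2)$, written $(a,b|c,d)=\{\{a,b\},\{c,d\}\}$, or $(4)$, written $(a,b,c,d)$; a quartet system is a set of quartets. Write $(a_1,a_2|\overline{b_1,b_2,b_3})$ for: at least one of $(a_1,a_2|b_1,b_2,b_3)$, $(a_1,a_2|b_1,b_2|b_3)$, $(a_1,a_2|b_1,b_3|b_2)$, $(a_1,a_2|b_2,b_3|b_1)$ belongs to $Q$. In each condition below, "$P$" means $P\in Q$, and the condition is required for all choices of letters in $X$ with all letters occurring in it pairwise distinct. $Q$ is saturated if: (i) $(a_1,a_2|b_1,b_2|c)\Rightarrow (a_1,a_2|b_1,b_2|x)\vee(a_1,x|b_1,b_2|c)\vee(a_1,a_2|b_1,x|c)$;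 (ii) $(a_1,a_2|b_1,b_2,b_3)\Rightarrow (a_1,x|b_1,b_2,b_3)\vee(a_1,a_2|\overline{b_1,b_2,x})$; (iii) $(a_1,a_2,a_3,a_4,a_5)\Rightarrow (a_1,a_2,a_3,a_4,x)\vee(a_1,x|a_2,a_3,a_4)\vee(a_2,x|a_1,a_3,a_4)\vee(a_3,x|a_1,a_2,a_4)\vee(a_4,x|a_1,a_2,a_3)$. $Q$ is transitive if: (i) $(a_1,a_2|b_1,x|c_1)\wedge(a_1,a_2|b_1,x|c_2)\Rightarrow(a_1,a_2|\overline{c_1,c_2,b_1})$; (ii) $(a_1,a_2|b_1,x|c_1)\wedge(a_1,a_2|b_2,x|c_1)\Rightarrow(a_1,a_2|b_1,b_2|c_1)$; (iii) $(a_1,x|b_1,b_2,b_3)\wedge(a_2,x|b_1,b_2,b_3)\Rightarrow(a_1,a_2|b_1,b_2,b_3)$; (iv) $(a_1,a_2|b_1,b_3,x)\wedge(a_1,a_2|b_2,b_3,x)\Rightarrow(a_1,a_2|b_1,b_2,b_3)\vee(a_1,a_2|b_1,b_2|b_3)$; (v) $(a_1,a_2|b_1,x,b_2)\wedge(a_1,a_2|b_1,x|b_3)\Rightarrow(a_1,a_2|b_1,b_2|b_3)$; (vi) $(a_1,a_2|b_1,b_2|x)\wedge(a_1,a_2|b_1,b_3,x)\Rightarrow(a_1,a_2|b_1,b_2|b_3)$. $Q$ is thin if for every $5$-subset $Y$ of $X$ exactly one quintet on $Y$ belongs to $Q$, and none of: (i) $(a,b|c,x|d)\wedge(a,c|b,y|d)$;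 (ii) $(a,b|c,d,x)\wedge(a,y|b,c,d)$; (iii) $(a,b|c,x|d)\wedge(a,c,d|b,y)$; (iv) $(a,x|b,c,d)\wedge(a,d|b,c|y)$ occurs. The quartet system $S$ associated to $Q$: for pairwise distinct $a,b,c,d\in X$, $(a,b|c,d)\in S$ iff there is $y\in X\setminus\{a,b,c,d\}$ such that at least one of $(a,b|c,d|y)$, $(a,b|c,d,y)$, $(a,b|c,y|d)$, $(a,b|d,y|c)$, $(c,d|b,y|a)$, $(c,d|a,y|b)$, $(a,b,y|c,d)$ belongs to $Q$; and $(a,b,c,d)\in S$ iff none of $(a,b|c,d)$, $(a,c|b,d)$, $(a,d|b,c)$ belongs to $S$. -}

module Defs where

open import Data.Nat using (ℕ)
open import Data.Fin using (Fin)
open import Data.List using (List; []; _∷_)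
open import Data.List.Membership.Propositional using (_∈_)
open import Data.List.Relation.Unary.Any using (Any)
open import Data.List.Relation.Unary.AllPairs using (AllPairs)
open import Data.Product using (_×_; ∃)
open import Data.Sum using (_⊎_)
open import Data.Empty using (⊥)
open import Relation.Binary.PropositionalEquality using (_≢_)
open import Function.Bundles using (_⇔_)

-- The ground set X is Fin n.
-- Raw descriptions of quintets (letters are meant to be pairwise distinct):
--   q221 a b c d e  denotes  (a,b|c,d|e) = {{a,b},{c,d},{e}}
--   q32  a b c d e  denotes  (a,b|c,d,e) = {{a,b},{c,d,e}}
--   q5   a b c d e  denotes  (a,b,c,d,e) = {{a,b,c,d,e}}
data RawQuintet (n : ℕ) : Set where
  q221 q32 q5 : (a b c d e : Fin n) → RawQuintet n

module _ {n : ℕ} where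

  letters : RawQuintet n → List (Fin n)
  letters (q221 a b c d e) = a ∷ b ∷ c ∷ d ∷ e ∷ []
  letters (q32 a b c d e) = a ∷ b ∷ c ∷ d ∷ e ∷ []
  letters (q5 a b c d e) = a ∷ b ∷ c ∷ d ∷ e ∷ []

  blocks : RawQuintet n → List (List (Fin n))
  blocks (q221 a b c d e) = (a ∷ b ∷ []) ∷ (c ∷ d ∷ []) ∷ (e ∷ []) ∷ []
  blocks (q32 a b c d e) = (a ∷ b ∷ []) ∷ (c ∷ d ∷ e ∷ []) ∷ []
  blocks (q5 a b c d e) = (a ∷ b ∷ c ∷ d ∷ e ∷ []) ∷ []

  Distinct : List (Fin n) → Set
  Distinct = AllPairs _≢_

  IsQuintet : RawQuintet n → Set
  IsQuintet q = Distinct (letters q)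

  SameBlock : RawQuintet n → Fin n → Fin n → Set
  SameBlock q x y = Any (λ B → (x ∈ B) × (y ∈ B)) (blocks q)

  SameSupport : RawQuintet n → RawQuintet n → Set
  SameSupport q q' = ∀ x → (x ∈ letters q) ⇔ (x ∈ letters q')

  -- two descriptions denote the same partition
  _≈Q_ : RawQuintet n → RawQuintet n → Set
  q ≈Q q' = SameSupport q q' × (∀ x y → SameBlock q x y ⇔ SameBlock q' x y)

  -- A quintet system: a set of quintets, i.e. a predicate on descriptions
  -- that only holds of genuine quintets and depends only on the partition.
  record IsQuintetSystem (Q : RawQuintet n → Set) : Set where
    field
      onlyQuintets : ∀ q → Q q → IsQuintet q
      respects : ∀ q q' → q ≈Q q' → Q q → Q q'

  module _ (Q : RawQuintet n → Set) where

    Over : (a1 a2 b1 b2 b3 : Fin n) → Set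
    Over a1 a2 b1 b2 b3 =
      Q (q32 a1 a2 b1 b2 b3) ⊎ Q (q221 a1 a2 b1 b2 b3) ⊎
      Q (q221 a1 a2 b1 b3 b2) ⊎ Q (q221 a1 a2 b2 b3 b1)

    record Saturated : Set where
      field
        sat1 : ∀ a1 a2 b1 b2 c x → Distinct (a1 ∷ a2 ∷ b1 ∷ b2 ∷ c ∷ x ∷ []) →
          Q (q221 a1 a2 b1 b2 c) →
          Q (q221 a1 a2 b1 b2 x) ⊎ Q (q221 a1 x b1 b2 c) ⊎ Q (q221 a1 a2 b1 x c)
        sat2 : ∀ a1 a2 b1 b2 b3 x → Distinct (a1 ∷ a2 ∷ b1 ∷ b2 ∷ b3 ∷ x ∷ []) →
          Q (q32 a1 a2 b1 b2 b3) →
          Q (q32 a1 x b1 b2 b3) ⊎ Over a1 a2 b1 b2 x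
        sat3 : ∀ a1 a2 a3 a4 a5 x → Distinct (a1 ∷ a2 ∷ a3 ∷ a4 ∷ a5 ∷ x ∷ []) →
          Q (q5 a1 a2 a3 a4 a5) →
          Q (q5 a1 a2 a3 a4 x) ⊎ Q (q32 a1 x a2 a3 a4) ⊎ Q (q32 a2 x a1 a3 a4) ⊎
          Q (q32 a3 x a1 a2 a4) ⊎ Q (q32 a4 x a1 a2 a3)

    record Transitive : Set where
      field
        tr1 : ∀ a1 a2 b1 x c1 c2 → Distinct (a1 ∷ a2 ∷ b1 ∷ x ∷ c1 ∷ c2 ∷ []) →
          Q (q221 a1 a2 b1 x c1) → Q (q221 a1 a2 b1 x c2) → Over a1 a2 c1 c2 b1
        tr2 : ∀ a1 a2 b1 b2 x c1 → Distinct (a1 ∷ a2 ∷ b1 ∷ b2 ∷ x ∷ c1 ∷ []) →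
          Q (q221 a1 a2 b1 x c1) → Q (q221 a1 a2 b2 x c1) → Q (q221 a1 a2 b1 b2 c1)
        tr3 : ∀ a1 a2 x b1 b2 b3 → Distinct (a1 ∷ a2 ∷ x ∷ b1 ∷ b2 ∷ b3 ∷ []) →
          Q (q32 a1 x b1 b2 b3) → Q (q32 a2 x b1 b2 b3) → Q (q32 a1 a2 b1 b2 b3)
        tr4 : ∀ a1 a2 b1 b2 b3 x → Distinct (a1 ∷ a2 ∷ b1 ∷ b2 ∷ b3 ∷ x ∷ []) →
          Q (q32 a1 a2 b1 b3 x) → Q (q32 a1 a2 b2 b3 x) →
          Q (q32 a1 a2 b1 b2 b3) ⊎ Q (q221 a1 a2 b1 b2 b3)
        tr5 : ∀ a1 a2 b1 b2 b3 x → Distinct (a1 ∷ a2 ∷ b1 ∷ b2 ∷ b3 ∷ x ∷ []) →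
          Q (q32 a1 a2 b1 x b2) → Q (q221 a1 a2 b1 x b3) → Q (q221 a1 a2 b1 b2 b3)
        tr6 : ∀ a1 a2 b1 b2 b3 x → Distinct (a1 ∷ a2 ∷ b1 ∷ b2 ∷ b3 ∷ x ∷ []) →
          Q (q221 a1 a2 b1 b2 x) → Q (q32 a1 a2 b1 b3 x) → Q (q221 a1 a2 b1 b2 b3)

    record Thin : Set where
      field
        exists : ∀ a b c d e → Distinct (a ∷ b ∷ c ∷ d ∷ e ∷ []) →
          ∃ λ q → Q q × SameSupport q (q5 a b c d e)
        unique : ∀ q q' → Q q → Q q' → SameSupport q q' → q ≈Q q'
        no1 : ∀ a b c d x y → Distinct (a ∷ b ∷ c ∷ d ∷ x ∷ y ∷ []) →
          Q (q221 a b c x d) → Q (q221 a c b y d) → ⊥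
        no2 : ∀ a b c d x y → Distinct (a ∷ b ∷ c ∷ d ∷ x ∷ y ∷ []) →
          Q (q32 a b c d x) → Q (q32 a y b c d) → ⊥
        no3 : ∀ a b c d x y → Distinct (a ∷ b ∷ c ∷ d ∷ x ∷ y ∷ []) →
          Q (q221 a b c x d) → Q (q32 b y a c d) → ⊥
        no4 : ∀ a b c d x y → Distinct (a ∷ b ∷ c ∷ d ∷ x ∷ y ∷ []) →
          Q (q32 a x b c d) → Q (q221 a d b c y) → ⊥

    -- (a,b|c,d) ∈ S, S the quartet system associated to Q
    -- (for pairwise distinct a,b,c,d)
    InS : (a b c d : Fin n) → Set
    InS a b c d = ∃ λ y → Distinct (a ∷ b ∷ c ∷ d ∷ y ∷ []) ×
      (Q (q221 a b c d y) ⊎ Q (q32 a b c d y) ⊎ Q (q221 a b c y d) ⊎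
       Q (q221 a b d y c) ⊎ Q (q221 c d b y a) ⊎ Q (q221 c d a y b) ⊎
       Q (q32 c d a b y))

module Submission where

-- Call a quintet of Q on {a,b,c,d,y} a "display" of the pair {a,b}
-- against c,d when {a,b} is one of its blocks; the four possible shapes
-- (a,b|c,d,y), (a,b|c,d|y), (a,b|c,y|d), (a,b|d,y|c) are exactly the
-- disjuncts of Over a b c d y.  Reading off the seven cases in the definition
-- of S shows
--      (a,b|c,d) ∈ S  ⇔  {a,b} or {c,d} is displayed against the other pair.
-- The theorem thus reduces to a one-sided statement about displays: if {a,b}
-- is displayed against c,d and x is a new letter, then {a,x} is displayed
-- against c,d or {a,b} is displayed against c,x.  This follows from the
-- saturation axioms (i),(ii) applied to the displaying quintet with the new
-- letter x, and in one case transitivity (i).  Applying it to whichever pair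
-- of (a1,a2|b1,b2) is displayed gives the two alternatives of the theorem.

open import Defs
open import Data.Nat using (ℕ; suc)
open import Data.Fin using (Fin; zero; suc; #_; _≟_)
open import Data.List using (List; []; _∷_; [_]; _++_; length; lookup; map)
open import Data.List.Membership.Propositional using (_∈_; find; lose)
open import Data.List.Membership.Propositional.Properties using (∈-lookup)
open import Data.List.Relation.Unary.Any using (here; there)
open import Data.List.Relation.Unary.All as All using ([]; _∷_)
open import Data.List.Relation.Unary.All.Properties using (++⁺; ++⁻ˡ; ++⁻ʳ)
open import Data.List.Relation.Unary.AllPairs as AllPairs using ([]; _∷_)
open import Data.List.Relation.Unary.AllPairs.Properties using (map⁺)
open import Data.List.Relation.Unary.Unique.Propositional using (Unique)
import Data.List.Relation.Unary.Unique.DecPropositional as DecUnique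
open import Data.List.Relation.Binary.Permutation.Propositional
  using (_↭_; ↭-refl; ↭-sym; prep; swap)
open import Data.List.Relation.Binary.Permutation.Propositional.Properties
  using (∈-resp-↭; ++⁺ʳ; ++-comm)
open import Data.Product using (∃; _×_; _,_)
open import Data.Sum using (_⊎_; inj₁; inj₂)
import Data.Sum as Sum
open import Data.Empty using (⊥-elim)
open import Function.Bundles using (mk⇔)
open import Relation.Nullary using (yes; no)
open import Relation.Nullary.Decidable using (True; toWitness)
open import Relation.Binary.PropositionalEquality using (_≡_; _≢_; refl; sym; cong)

module _ {A : Set} where

  lookup-injective : ∀ {xs : List A} → Unique xs →
    ∀ i j → lookup xs i ≡ lookup xs j → i ≡ j
  lookup-injective (_ ∷ _) zero zero _ = refl
  lookup-injective (x∉ ∷ _) zero (suc j) eq = ⊥-elim (All.lookup x∉ (∈-lookup j) eq)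
  lookup-injective (x∉ ∷ _) (suc i) zero eq = ⊥-elim (All.lookup x∉ (∈-lookup i) (sym eq))
  lookup-injective (_ ∷ u) (suc i) (suc j) eq = cong suc (lookup-injective u i j eq)

  -- Reading a repetition-free list at distinct positions gives a
  -- repetition-free list; the distinctness of the positions is checked by
  -- computation, so this is how all reorderings of letters are justified.
  select : ∀ {xs : List A} → Unique xs → (is : List (Fin (length xs))) →
    {True (DecUnique.unique? _≟_ is)} → Unique (map (lookup xs) is)
  select u is {distinct} =
    map⁺ (AllPairs.map
      (λ i≢j eq → i≢j (lookup-injective u _ _ eq)) (toWitness distinct))

  unique-snoc₂ : ∀ xs {x y : A} → Unique (xs ++ [ x ]) → Unique (xs ++ [ y ]) →
    x ≢ y → Unique (xs ++ x ∷ y ∷ [])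
  unique-snoc₂ [] _ _ x≢y = (x≢y ∷ []) ∷ [] ∷ []
  unique-snoc₂ (z ∷ zs) (z∉x ∷ ux) (z∉y ∷ uy) x≢y =
    ++⁺ (++⁻ˡ zs z∉x) (All.head (++⁻ʳ zs z∉x) ∷ ++⁻ʳ zs z∉y) ∷ unique-snoc₂ zs ux uy x≢y

module _ {n : ℕ} where
  private variable a b c d e : Fin n

  BlocksMatch : RawQuintet n → RawQuintet n → Set
  BlocksMatch q q' = ∀ {B} → B ∈ blocks q → ∃ λ B' → B' ∈ blocks q' × B ↭ B'

  sameBlock-transport : ∀ {q q'} → BlocksMatch q q' →
    ∀ {x y} → SameBlock q x y → SameBlock q' x y
  sameBlock-transport match s with find s
  ... | B , B∈q , x∈B , y∈B with match B∈q
  ... | B' , B'∈q' , B↭B' = lose B'∈q' (∈-resp-↭ B↭B' x∈B , ∈-resp-↭ B↭B' y∈B)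

  ≈Q-intro : ∀ q q' → letters q ↭ letters q' →
    BlocksMatch q q' → BlocksMatch q' q → q ≈Q q'
  ≈Q-intro _ _ σ match match′ =
    (λ _ → mk⇔ (∈-resp-↭ σ) (∈-resp-↭ (↭-sym σ))) ,
    (λ _ _ → mk⇔ (sameBlock-transport match) (sameBlock-transport match′))

  swap-second-pair : q221 a b c d e ≈Q q221 a b d c e
  swap-second-pair {a} {b} {c} {d} {e} =
    ≈Q-intro (q221 a b c d e) (q221 a b d c e) (prep a (prep b (swap c d ↭-refl)))
      match match
    where
    match : ∀ {a b c d e} → BlocksMatch (q221 a b c d e) (q221 a b d c e)
    match (here refl) = _ , here refl , ↭-refl
    match (there (here refl)) = _ , there (here refl) , swap _ _ ↭-refl
    match (there (there (here refl))) = _ , there (there (here refl)) , ↭-refl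
    match (there (there (there ())))

  swap-in-triple : q32 a b c d e ≈Q q32 a b c e d
  swap-in-triple {a} {b} {c} {d} {e} =
    ≈Q-intro (q32 a b c d e) (q32 a b c e d) (prep a (prep b (prep c (swap d e ↭-refl))))
      match match
    where
    match : ∀ {a b c d e} → BlocksMatch (q32 a b c d e) (q32 a b c e d)
    match (here refl) = _ , here refl , ↭-refl
    match (there (here refl)) = _ , there (here refl) , prep _ (swap _ _ ↭-refl)
    match (there (there ()))

  swap-pairs : q221 a b c d e ≈Q q221 c d a b e
  swap-pairs {a} {b} {c} {d} {e} =
    ≈Q-intro (q221 a b c d e) (q221 c d a b e)
      (++⁺ʳ [ e ] (++-comm (a ∷ b ∷ []) (c ∷ d ∷ []))) match match
    where
    match : ∀ {a b c d e} → BlocksMatch (q221 a b c d e) (q221 c d a b e)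
    match (here refl) = _ , there (here refl) , ↭-refl
    match (there (here refl)) = _ , here refl , ↭-refl
    match (there (there (here refl))) = _ , there (there (here refl)) , ↭-refl
    match (there (there (there ())))

pattern ab∣cdy q = inj₁ q
pattern ab∣cd∣y q = inj₂ (inj₁ q)
pattern ab∣cy∣d q = inj₂ (inj₂ (inj₁ q))
pattern ab∣dy∣c q = inj₂ (inj₂ (inj₂ q))

module Displays {n : ℕ} (Q : RawQuintet n → Set) (isQ : IsQuintetSystem Q) where
  open IsQuintetSystem isQ
  private variable a b c d e : Fin n

  Q-swap-second-pair : Q (q221 a b c d e) → Q (q221 a b d c e)
  Q-swap-second-pair = respects _ _ swap-second-pair

  Q-swap-in-triple : Q (q32 a b c d e) → Q (q32 a b c e d)
  Q-swap-in-triple = respects _ _ swap-in-triple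

  Q-swap-pairs : Q (q221 a b c d e) → Q (q221 c d a b e)
  Q-swap-pairs = respects _ _ swap-pairs

  Displayed : (a b c d : Fin n) → Set
  Displayed a b c d = ∃ λ y → Over Q a b c d y

  over-distinct : ∀ {y} → Over Q a b c d y → Distinct (a ∷ b ∷ c ∷ d ∷ y ∷ [])
  over-distinct (ab∣cdy q) = onlyQuintets _ q
  over-distinct (ab∣cd∣y q) = onlyQuintets _ q
  over-distinct (ab∣cy∣d q) = select (onlyQuintets _ q) (# 0 ∷ # 1 ∷ # 2 ∷ # 4 ∷ # 3 ∷ [])
  over-distinct (ab∣dy∣c q) = select (onlyQuintets _ q) (# 0 ∷ # 1 ∷ # 4 ∷ # 2 ∷ # 3 ∷ [])

  over-swap : Over Q a b c d e → Over Q a b c e d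
  over-swap (ab∣cdy q) = ab∣cdy (Q-swap-in-triple q)
  over-swap (ab∣cd∣y q) = ab∣cy∣d q
  over-swap (ab∣cy∣d q) = ab∣cd∣y q
  over-swap (ab∣dy∣c q) = ab∣dy∣c (Q-swap-second-pair q)

  inS-display : InS Q a b c d → Displayed a b c d ⊎ Displayed c d a b
  inS-display (y , _ , inj₁ q) = inj₁ (y , ab∣cd∣y q)
  inS-display (y , _ , inj₂ (inj₁ q)) = inj₁ (y , ab∣cdy q)
  inS-display (y , _ , inj₂ (inj₂ (inj₁ q))) = inj₁ (y , ab∣cy∣d q)
  inS-display (y , _ , inj₂ (inj₂ (inj₂ (inj₁ q)))) = inj₁ (y , ab∣dy∣c q)
  inS-display (y , _ , inj₂ (inj₂ (inj₂ (inj₂ (inj₁ q))))) = inj₂ (y , ab∣dy∣c q)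
  inS-display (y , _ , inj₂ (inj₂ (inj₂ (inj₂ (inj₂ (inj₁ q)))))) = inj₂ (y , ab∣cy∣d q)
  inS-display (y , _ , inj₂ (inj₂ (inj₂ (inj₂ (inj₂ (inj₂ q)))))) = inj₂ (y , ab∣cdy q)

  inS-from-display : Displayed a b c d → InS Q a b c d
  inS-from-display (y , o@(ab∣cdy q)) = y , over-distinct o , inj₂ (inj₁ q)
  inS-from-display (y , o@(ab∣cd∣y q)) = y , over-distinct o , inj₁ q
  inS-from-display (y , o@(ab∣cy∣d q)) = y , over-distinct o , inj₂ (inj₂ (inj₁ q))
  inS-from-display (y , o@(ab∣dy∣c q)) = y , over-distinct o , inj₂ (inj₂ (inj₂ (inj₁ q)))

  over-distinct-mirror : ∀ {y} → Over Q c d a b y → Distinct (a ∷ b ∷ c ∷ d ∷ y ∷ [])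
  over-distinct-mirror o = select (over-distinct o) (# 2 ∷ # 3 ∷ # 0 ∷ # 1 ∷ # 4 ∷ [])

  inS-from-mirror : Displayed c d a b → InS Q a b c d
  inS-from-mirror (y , o@(ab∣cd∣y q)) = y , over-distinct-mirror o , inj₁ (Q-swap-pairs q)
  inS-from-mirror (y , o@(ab∣dy∣c q)) =
    y , over-distinct-mirror o , inj₂ (inj₂ (inj₂ (inj₂ (inj₁ q))))
  inS-from-mirror (y , o@(ab∣cy∣d q)) =
    y , over-distinct-mirror o , inj₂ (inj₂ (inj₂ (inj₂ (inj₂ (inj₁ q)))))
  inS-from-mirror (y , o@(ab∣cdy q)) =
    y , over-distinct-mirror o , inj₂ (inj₂ (inj₂ (inj₂ (inj₂ (inj₂ q)))))

module DisplaySaturation {n : ℕ} (Q : RawQuintet n → Set) (isQ : IsQuintetSystem Q)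
  (tr : Transitive Q) (sat : Saturated Q) where
  open Displays Q isQ
  open Transitive tr using (tr1)
  open Saturated sat using (sat1; sat2)
  private variable a b c d x y : Fin n

  distinct-dyc : Distinct (a ∷ b ∷ c ∷ d ∷ y ∷ x ∷ []) → Distinct (a ∷ b ∷ d ∷ y ∷ c ∷ x ∷ [])
  distinct-dyc D = select D (# 0 ∷ # 1 ∷ # 3 ∷ # 4 ∷ # 2 ∷ # 5 ∷ [])

  -- The saturation axiom for the shape of the display either keeps
  -- {a,b} as a block (now displayed against c,x) or replaces b by x.  In the
  -- shape (a,b|d,y|c) the first alternative gives (a,b|d,y|x), and
  -- transitivity (i) combines it with (a,b|d,y|c) into (a,b|overline{c,x,d}).
  display-extend : Distinct (a ∷ b ∷ c ∷ d ∷ y ∷ x ∷ []) → Over Q a b c d y →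
    Displayed a x c d ⊎ Displayed a b c x
  display-extend {a} {b} {c} {d} {y} {x} D (ab∣cdy h) with sat2 a b c d y x D h
  ... | inj₁ ax∣cdy = inj₁ (y , ab∣cdy ax∣cdy)
  ... | inj₂ ab∣over-cdx = inj₂ (d , over-swap ab∣over-cdx)
  display-extend {a} {b} {c} {d} {y} {x} D (ab∣cd∣y h) with sat1 a b c d y x D h
  ... | inj₁ ab∣cd∣x = inj₂ (d , ab∣cy∣d ab∣cd∣x)
  ... | inj₂ (inj₁ ax∣cd∣y) = inj₁ (y , ab∣cd∣y ax∣cd∣y)
  ... | inj₂ (inj₂ ab∣cx∣y) = inj₂ (y , ab∣cd∣y ab∣cx∣y)
  display-extend {a} {b} {c} {d} {y} {x} D (ab∣cy∣d h)
    with sat1 a b c y d x (select D (# 0 ∷ # 1 ∷ # 2 ∷ # 4 ∷ # 3 ∷ # 5 ∷ [])) h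
  ... | inj₁ ab∣cy∣x = inj₂ (y , ab∣cy∣d ab∣cy∣x)
  ... | inj₂ (inj₁ ax∣cy∣d) = inj₁ (y , ab∣cy∣d ax∣cy∣d)
  ... | inj₂ (inj₂ ab∣cx∣d) = inj₂ (d , ab∣cd∣y ab∣cx∣d)
  display-extend {a} {b} {c} {d} {y} {x} D (ab∣dy∣c h)
    with sat1 a b d y c x (distinct-dyc D) h
  ... | inj₁ ab∣dy∣x = inj₂ (d , tr1 a b d y c x (distinct-dyc D) h ab∣dy∣x)
  ... | inj₂ (inj₁ ax∣dy∣c) = inj₁ (y , ab∣dy∣c ax∣dy∣c)
  ... | inj₂ (inj₂ ab∣dx∣c) = inj₂ (d , over-swap (ab∣dy∣c ab∣dx∣c))

  -- When the display already uses x it directly displays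
  -- {a,b} against c,x.
  display-saturated : Distinct (a ∷ b ∷ c ∷ d ∷ x ∷ []) → Displayed a b c d →
    Displayed a x c d ⊎ Displayed a b c x
  display-saturated {a} {b} {c} {d} {x} D (y , o) with y ≟ x
  ... | yes refl = inj₂ (d , over-swap o)
  ... | no y≢x = display-extend (unique-snoc₂ (a ∷ b ∷ c ∷ d ∷ []) (over-distinct o) D y≢x) o

  -- Whichever pair of
  -- (a1,a2|b1,b2) is displayed, saturation of displays adds x next to a1
  -- (resp. b1), and the new display witnesses the corresponding quartet.
  S-saturated : ∀ a1 a2 b1 b2 x → Distinct (a1 ∷ a2 ∷ b1 ∷ b2 ∷ x ∷ []) →
    InS Q a1 a2 b1 b2 → InS Q a1 x b1 b2 ⊎ InS Q a1 a2 b1 x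
  S-saturated a1 a2 b1 b2 x D a1a2∣b1b2 with inS-display a1a2∣b1b2
  ... | inj₁ a-pair =
    Sum.map inS-from-display inS-from-display (display-saturated D a-pair)
  ... | inj₂ b-pair =
    Sum.swap (Sum.map inS-from-mirror inS-from-mirror
      (display-saturated (select D (# 2 ∷ # 3 ∷ # 0 ∷ # 1 ∷ # 4 ∷ [])) b-pair))

-- Proposition 3.8.
proposition3p8 : (m : ℕ) (Q : RawQuintet (suc m) → Set) →
    IsQuintetSystem Q → Thin Q → Transitive Q → Saturated Q →
    ∀ (a1 a2 b1 b2 x : Fin (suc m)) → Distinct (a1 ∷ a2 ∷ b1 ∷ b2 ∷ x ∷ []) →
    InS Q a1 a2 b1 b2 → InS Q a1 x b1 b2 ⊎ InS Q a1 a2 b1 x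
proposition3p8 m Q isQ _ tr sat = DisplaySaturation.S-saturated Q isQ tr sat
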